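{- Let $T$ be a finite tree and let $H$ be a hub labeling of $T$ produced by a recursive decomposition (as described in the context), with associated subtrees $T_u$. Let $r_1\prec r_2$ (i.e. $r_2\in T_{r_1}$, $r_2\neq r_1$), and let $H'$ be obtained from $H$ by moving $r_2$ ahead of $r_1$. Let $\widetilde T$ be the connected component of $T_{r_1}-r_2$ that contains $r_1$. Then: (1) if $u\notin T_{r_1}$, then $H'_u=H_u$; (2) if $u\in T_{r_1}$, then $H'_u\subseteq H_u\cup\{r_2\}$; (3) if $u\in T_{r_1}\setminus\widetilde T$, then $r_1\notin H'_u$.
   Context: For a tree $T=(V,E)$ and $u,v\in V$, let $P_{uv}$ be the vertex set of the unique $u$–$v$ path. A hub labeling of $T$ is a family $\{H_u\}_{u\in V}$ of subsets of $V$ with $H_u\cap H_v\cap P_{uv}\neq\varnothing$ for all $u,v\in V$ (including $u=v$). A recursive decomposition builds a hub labeling as follows: when processing a subtree $T'$ (starting with $T'=T$ and all $H_v=\varnothing$), choose a vertex $r\in T'$, add $r$ to $H_v$ for every $v\in T'$, and recursively process each connected component of $T'-r$. For each vertex $u$, $T_u$ denotes the subtree being processed at the step in which $u$ is chosen. Write $u\preceq v$ if $u\in H_v$, and $u\prec v$ if $u\preceq v$ and $u\neq v$; thus $u\prec v$ iff $v\in T_u\setminus\{u\}$. For a connected subtree $T'$ of $T$, the vertex of highest rank in $T'$ is the vertex of $T'$ chosen earliest in this recursive process (well defined since $T'$ is connected). Moving $r_2$ ahead of $r_1$ (for $r_1\prec r_2$) produces the hub labeling $H'$ obtained by running the same recursive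 process, except that when the subtree $T_{r_1}$ is processed, $r_2$ is chosen instead of $r_1$, and afterwards, whenever a subtree $T''$ of $T_{r_1}$ is processed, the vertex of highest rank in $T''$ (with respect to $H$) is chosen; outside $T_{r_1}$ the choices are unchanged. -}

module Defs where

open import Data.Nat using (ℕ)
open import Data.Fin using (Fin)
open import Data.Bool using (Bool; T)
open import Data.List using (List; []; _∷_)
open import Data.List.Relation.Unary.Unique.Propositional using (Unique)
open import Data.Product using (Σ; _×_; _,_; ∃)
open import Data.Sum using (_⊎_)
open import Data.Empty using (⊥)
open import Data.Unit using (⊤)
open import Relation.Nullary using (¬_)
open import Relation.Binary.PropositionalEquality using (_≡_; _≢_)
open import Data.Fin.Subset using (Subset; _∈_; _∉_; _⊆_) renaming (⊤ to Full)

Graph : ℕ → Set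
Graph n = Fin n → Fin n → Bool

Edge : ∀ {n} → Graph n → Fin n → Fin n → Set
Edge G x y = T (G x y)

data Reach {n} (G : Graph n) (P : Fin n → Set) (x : Fin n) : Fin n → Set where
  here : P x → Reach G P x x
  step : ∀ {y z} → Reach G P x y → Edge G y z → P z → Reach G P x z

data Walk {n} (G : Graph n) : Fin n → Fin n → List (Fin n) → Set where
  stop : ∀ {x} → Walk G x x (x ∷ [])
  step : ∀ {x y z vs} → Edge G x y → Walk G y z vs → Walk G x z (x ∷ vs)

AllV : ∀ {n} → Fin n → Set
AllV _ = ⊤

record IsTree {n} (G : Graph n) : Set where
  field
    sym      : ∀ x y → Edge G x y → Edge G y x
    irrefl   : ∀ x → ¬ Edge G x x
    conn     : ∀ x y → Reach G AllV x y
    acyclic  : ∀ x y vs ws → Walk G x y vs → Unique vs → Walk G x y ws → Unique ws → vs ≡ ws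

Minus : ∀ {n} → Subset n → Fin n → Fin n → Set
Minus S r z = (z ∈ S) × (z ≢ r)

-- A recursive decomposition is described by its choice function c: when a
-- subtree (given as a vertex subset S) is processed, the vertex c S is chosen.
data Proc {n} (G : Graph n) (c : Subset n → Fin n) : Subset n → Set where
  root  : Proc G c Full
  child : ∀ {S S'} → Proc G c S → (x : Fin n) → Minus S (c S) x →
          (∀ y → (y ∈ S' → Reach G (Minus S (c S)) x y)
               × (Reach G (Minus S (c S)) x y → y ∈ S')) →
          Proc G c S'

ValidChooser : ∀ {n} → Graph n → (Subset n → Fin n) → Set
ValidChooser G c = ∀ S → Proc G c S → c S ∈ S

-- IsT G c u S : S = T_u, the subtree being processed when u is chosen.
IsT : ∀ {n} → Graph n → (Subset n → Fin n) → Fin n → Subset n → Set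
IsT G c u S = Proc G c S × (c S ≡ u)

-- Hub G c u v : u ∈ H_v  (u ⪯ v) for the hub labeling produced by c.
Hub : ∀ {n} → Graph n → (Subset n → Fin n) → Fin n → Fin n → Set
Hub G c u v = ∃ λ S → IsT G c u S × (v ∈ S)

-- c' is the choice function obtained from c by moving r₂ ahead of r₁, where
-- S₁ = T_{r₁} (w.r.t. c): at S₁ choose r₂; at every other processed subtree
-- contained in S₁ choose the vertex of highest rank w.r.t. H (the vertex of
-- the subtree that is in H_v for every v of the subtree); elsewhere unchanged.
MoveAhead : ∀ {n} → Graph n → (Subset n → Fin n) → Subset n → Fin n →
            (Subset n → Fin n) → Set
MoveAhead G c S₁ r₂ c' =
    (c' S₁ ≡ r₂)
  × (∀ S → Proc G c' S → S ≢ S₁ → S ⊆ S₁ →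
       (c' S ∈ S) × (∀ v → v ∈ S → Hub G c (c' S) v))
  × (∀ S → Proc G c' S → ¬ (S ⊆ S₁) → c' S ≡ c S)

-- The subtrees processed by a recursive decomposition form a laminar family:
-- two of them are disjoint or nested, and nesting is strict below the chosen
-- vertex.  Outside T_{r₁} the two processes choose the same vertices, so they
-- process the same subtrees there, which gives (1).  Inside T_{r₁} the new
-- process chooses r₂ at T_{r₁} and otherwise only vertices that were already
-- hubs, which gives (2).  For (3), r₁ is not chosen outside T_{r₁} because T_{r₁}
-- is the unique subtree at which r₁ was chosen; inside, any subtree at which r₁
-- is chosen is a connected part of T_{r₁} - r₂ containing r₁, hence inside T̃.
module Submission where

open import Defs
open import Data.Fin using (Fin)
open import Data.Product using (_×_; _,_; proj₁; proj₂)
open import Data.Sum using (_⊎_; inj₁; inj₂)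
open import Data.Empty using (⊥-elim)
open import Relation.Nullary using (¬_; yes; no)
open import Relation.Binary.Definitions using (DecidableEquality)
open import Relation.Binary.PropositionalEquality using (_≡_; _≢_; refl; sym; trans; subst)
open import Data.Fin.Subset using (Subset; _∈_; _∉_; _⊆_) renaming (⊤ to Full)
open import Data.Fin.Subset.Properties using (∈⊤; ⊆-antisym; ⊆-reflexive; _⊆?_)
open import Data.Vec.Properties using (≡-dec)
import Data.Bool.Properties as Bool

_≟ˢ_ : ∀ {n} → DecidableEquality (Subset n)
_≟ˢ_ = ≡-dec Bool._≟_

module Reachability {n} (G : Graph n) where

  reach-last : ∀ {P : Fin n → Set} {x y} → Reach G P x y → P y
  reach-last (here p)     = p
  reach-last (step _ _ p) = p

  reach-map : ∀ {P Q : Fin n → Set} {x y} → (∀ {z} → P z → Q z) → Reach G P x y → Reach G Q x y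
  reach-map f (here p)     = here (f p)
  reach-map f (step r e p) = step (reach-map f r) e (f p)

  reach-++ : ∀ {P : Fin n → Set} {x y z} → Reach G P x y → Reach G P y z → Reach G P x z
  reach-++ r (here _)     = r
  reach-++ r (step s e p) = step (reach-++ r s) e p

  reach-prefixes : ∀ {P : Fin n → Set} {x y} → Reach G P x y → Reach G (Reach G P x) x y
  reach-prefixes (here p)     = here (here p)
  reach-prefixes (step r e p) = step (reach-prefixes r) e (step r e p)

  -- The shape of the last field of Proc.child.
  IsComponent : Subset n → Fin n → Fin n → Subset n → Set
  IsComponent S r x S' = ∀ y → (y ∈ S' → Reach G (Minus S r) x y) × (Reach G (Minus S r) x y → y ∈ S')

  Connected : Subset n → Set
  Connected A = ∀ {y z} → y ∈ A → z ∈ A → Reach G (_∈ A) y z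

  component-avoids : ∀ {S r x S' y} → IsComponent S r x S' → y ∈ S' → Minus S r y
  component-avoids comp y∈S' = reach-last (proj₁ (comp _) y∈S')

  component-⊆ : ∀ {S r x S'} → IsComponent S r x S' → S' ⊆ S
  component-⊆ comp y∈S' = proj₁ (component-avoids comp y∈S')

  module _ (symmetric : ∀ x y → Edge G x y → Edge G y x) where

    reach-reverse : ∀ {P : Fin n → Set} {x y} → Reach G P x y → Reach G P y x
    reach-reverse (here p)      = here p
    reach-reverse (step r e pz) =
      reach-++ (step (here pz) (symmetric _ _ e) (reach-last r)) (reach-reverse r)

    component-connected : ∀ {S r x S'} → IsComponent S r x S' → Connected S'
    component-connected {x = x} {S'} comp y∈S' z∈S' = reach-++ (reach-reverse (from-x y∈S')) (from-x z∈S')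
      where
        from-x : ∀ {w} → w ∈ S' → Reach G (_∈ S') x w
        from-x {w} w∈S' = reach-map (λ {v} → proj₂ (comp v)) (reach-prefixes (proj₁ (comp w) w∈S'))

    component-absorbs : ∀ {S r x S' A z} → IsComponent S r x S' → Connected A →
                        (∀ {y} → y ∈ A → Minus S r y) → z ∈ A → z ∈ S' → A ⊆ S'
    component-absorbs {z = z} comp A-conn A-avoids z∈A z∈S' {y} y∈A =
      proj₂ (comp y) (reach-++ (proj₁ (comp z) z∈S') (reach-map A-avoids (A-conn z∈A y∈A)))

module Decomposition {n} (G : Graph n) (symmetric : ∀ x y → Edge G x y → Edge G y x)
                     (c : Subset n → Fin n) where
  open Reachability G

  Below : Subset n → Subset n → Set
  Below A B = ∀ {y} → y ∈ A → Minus B (c B) y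

  Laminar : Subset n → Subset n → Set
  Laminar A B = A ≡ B ⊎ Below A B ⊎ Below B A

  laminar-swap : ∀ {A B} → Laminar A B → Laminar B A
  laminar-swap (inj₁ A≡B)        = inj₁ (sym A≡B)
  laminar-swap (inj₂ (inj₁ A<B)) = inj₂ (inj₂ A<B)
  laminar-swap (inj₂ (inj₂ B<A)) = inj₂ (inj₁ B<A)

  below-choice∉ : ∀ {A B} → Below A B → c B ∉ A
  below-choice∉ A<B cB∈A = proj₂ (A<B cB∈A) refl

  processed-connected : (∀ x y → Reach G AllV x y) → ∀ {S} → Proc G c S → Connected S
  processed-connected conn root _ _ = reach-map (λ _ → ∈⊤) (conn _ _)
  processed-connected conn (child _ _ _ comp) = component-connected symmetric comp

  laminar-child : ∀ {A P x B} → Laminar A P → IsComponent P (c P) x B →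
                  (Below A P → Laminar A B) → Laminar A B
  laminar-child (inj₁ refl)       B-comp _ = inj₂ (inj₂ (component-avoids B-comp))
  laminar-child (inj₂ (inj₁ A<P)) _      k = k A<P
  laminar-child (inj₂ (inj₂ P<A)) B-comp _ = inj₂ (inj₂ (λ y∈B → P<A (component-⊆ B-comp y∈B)))

  laminar-root : ∀ {B} → Proc G c B → Laminar Full B
  laminar-root root                  = inj₁ refl
  laminar-root (child pB _ _ B-comp) =
    laminar-child (laminar-root pB) B-comp (λ Full<P → ⊥-elim (below-choice∉ Full<P ∈⊤))

  -- In the last case A and B are components of their parents, each avoiding
  -- the other's parent choice; being connected and meeting at z, they coincide.
  laminar : ∀ {A B z} → Proc G c A → Proc G c B → z ∈ A → z ∈ B → Laminar A B
  laminar root pB _ _ = laminar-root pB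
  laminar pA@(child _ _ _ _) root _ _ = laminar-swap (laminar-root pA)
  laminar pA@(child qA _ _ A-comp) pB@(child qB _ _ B-comp) z∈A z∈B =
    laminar-child (laminar pA qB z∈A (component-⊆ B-comp z∈B)) B-comp λ A<PB →
    laminar-swap (laminar-child (laminar-swap (laminar qA pB (component-⊆ A-comp z∈A) z∈B)) A-comp λ B<PA →
    inj₁ (⊆-antisym (component-absorbs symmetric A-comp (component-connected symmetric B-comp) B<PA z∈B z∈A)
                    (component-absorbs symmetric B-comp (component-connected symmetric A-comp) A<PB z∈A z∈B)))

  IsT-unique : ValidChooser G c → ∀ {w A B} → IsT G c w A → IsT G c w B → A ≡ B
  IsT-unique valid {A = A} {B} (pA , refl) (pB , cB≡cA) = from-laminar (laminar pA pB cA∈A cA∈B)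
    where
      cA∈A : c A ∈ A
      cA∈A = valid A pA
      cA∈B : c A ∈ B
      cA∈B = subst (_∈ B) cB≡cA (valid B pB)
      from-laminar : Laminar A B → A ≡ B
      from-laminar (inj₁ A≡B)        = A≡B
      from-laminar (inj₂ (inj₁ A<B)) = ⊥-elim (proj₂ (A<B cA∈A) (sym cB≡cA))
      from-laminar (inj₂ (inj₂ B<A)) = ⊥-elim (below-choice∉ B<A cA∈B)

  ⊂⇒below : ∀ {A B} → c A ∈ A → Proc G c A → Proc G c B → A ⊆ B → A ≢ B → Below A B
  ⊂⇒below cA∈A pA pB A⊆B A≢B with laminar pA pB cA∈A (A⊆B cA∈A)
  ... | inj₁ A≡B        = ⊥-elim (A≢B A≡B)
  ... | inj₂ (inj₁ A<B) = A<B
  ... | inj₂ (inj₂ B<A) = ⊥-elim (below-choice∉ B<A (A⊆B cA∈A))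

module Agreement {n} (G : Graph n) {c d : Subset n → Fin n} (X : Subset n)
                 (agree : ∀ S → Proc G d S → ¬ S ⊆ X → d S ≡ c S) where
  open Reachability G

  child-chosen : ∀ {e : Subset n → Fin n} {P S' r} → Proc G e P → e P ≡ r →
                 (x : Fin n) → Minus P r x → IsComponent P r x S' → Proc G e S'
  child-chosen p refl = child p

  parent-⊈ : ∀ {P r x S'} → IsComponent P r x S' → ¬ S' ⊆ X → ¬ P ⊆ X
  parent-⊈ comp S'⊈X P⊆X = S'⊈X (λ y∈S' → P⊆X (component-⊆ comp y∈S'))

  ∈∉⇒⊈ : ∀ {u S} → u ∈ S → u ∉ X → ¬ S ⊆ X
  ∈∉⇒⊈ u∈S u∉X S⊆X = u∉X (S⊆X u∈S)

  proc-c⇒d : ∀ {S} → Proc G c S → ¬ S ⊆ X → Proc G d S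
  proc-c⇒d root                    _    = root
  proc-c⇒d (child {P} p x m comp) S⊈X = child-chosen p′ (agree P p′ P⊈X) x m comp
    where
      P⊈X : ¬ P ⊆ X
      P⊈X = parent-⊈ comp S⊈X
      p′ : Proc G d P
      p′ = proc-c⇒d p P⊈X

  proc-d⇒c : ∀ {S} → Proc G d S → ¬ S ⊆ X → Proc G c S
  proc-d⇒c root                    _    = root
  proc-d⇒c (child {P} p x m comp) S⊈X =
    child-chosen (proc-d⇒c p P⊈X) (sym (agree P p P⊈X)) x m comp
    where
      P⊈X : ¬ P ⊆ X
      P⊈X = parent-⊈ comp S⊈X

  -- The parent of X is not inside X, as it contains the vertex chosen there.
  proc-c⇒d-self : ValidChooser G c → Proc G c X → Proc G d X
  proc-c⇒d-self _     root                    = root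
  proc-c⇒d-self valid (child {P} p x m comp) = child-chosen p′ (agree P p′ P⊈X) x m comp
    where
      P⊈X : ¬ P ⊆ X
      P⊈X P⊆X = proj₂ (component-avoids comp (P⊆X (valid P p))) refl
      p′ : Proc G d P
      p′ = proc-c⇒d p P⊈X

  IsT-d⇒c : ∀ {w S} → IsT G d w S → ¬ S ⊆ X → IsT G c w S
  IsT-d⇒c (p , refl) S⊈X = proc-d⇒c p S⊈X , sym (agree _ p S⊈X)

  IsT-c⇒d : ∀ {w S} → IsT G c w S → ¬ S ⊆ X → IsT G d w S
  IsT-c⇒d {S = S} (p , refl) S⊈X = p′ , agree S p′ S⊈X
    where
      p′ : Proc G d S
      p′ = proc-c⇒d p S⊈X

  hub-d⇒c : ∀ {u w} → u ∉ X → Hub G d w u → Hub G c w u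
  hub-d⇒c u∉X (S , T , u∈S) = S , IsT-d⇒c T (∈∉⇒⊈ u∈S u∉X) , u∈S

  hub-c⇒d : ∀ {u w} → u ∉ X → Hub G c w u → Hub G d w u
  hub-c⇒d u∉X (S , T , u∈S) = S , IsT-c⇒d T (∈∉⇒⊈ u∈S u∉X) , u∈S

hub-moveAhead : ∀ {n} {G : Graph n} {c c′ : Subset n → Fin n} {S₁ r₂ u w} →
                MoveAhead G c S₁ r₂ c′ → Hub G c′ w u → Hub G c w u ⊎ w ≡ r₂
hub-moveAhead {G = G} {S₁ = S₁} (c′S₁≡r₂ , inside , outside) (S , (p , refl) , u∈S)
  with S ⊆? S₁ | S ≟ˢ S₁
... | no S⊈S₁  | _         = inj₁ (S , Agreement.IsT-d⇒c G S₁ outside (p , refl) S⊈S₁ , u∈S)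
... | yes _    | yes refl  = inj₂ c′S₁≡r₂
... | yes S⊆S₁ | no S≢S₁   = inj₁ (proj₂ (inside S p S≢S₁ S⊆S₁) _ u∈S)

r₁-not-hub-beyond-r₂ : ∀ {n} {G : Graph n} → IsTree G → ∀ {c c′ : Subset n → Fin n} →
                       ValidChooser G c → ∀ {r₁ r₂ S₁ u} → IsT G c r₁ S₁ → r₂ ≢ r₁ →
                       MoveAhead G c S₁ r₂ c′ → ¬ Reach G (Minus S₁ r₂) r₁ u → ¬ Hub G c′ r₁ u
r₁-not-hub-beyond-r₂ {G = G} tree {c} {c′} valid {r₁} {r₂} {S₁} T₁ r₂≢r₁
                     (c′S₁≡r₂ , inside , outside) unreachable (S , (p , c′S≡r₁) , u∈S) with S ⊆? S₁ | S ≟ˢ S₁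
... | no S⊈S₁  | _        =
  S⊈S₁ (⊆-reflexive (D.IsT-unique valid (Agreement.IsT-d⇒c G S₁ outside (p , c′S≡r₁) S⊈S₁) T₁))
  where module D = Decomposition G (IsTree.sym tree) c
... | yes _    | yes refl = r₂≢r₁ (trans (sym c′S₁≡r₂) c′S≡r₁)
... | yes S⊆S₁ | no S≢S₁  =
  unreachable (reach-map avoids-r₂ (D′.processed-connected (IsTree.conn tree) p r₁∈S u∈S))
  where
    open Reachability G
    module D′ = Decomposition G (IsTree.sym tree) c′
    c′S∈S : c′ S ∈ S
    c′S∈S = proj₁ (inside S p S≢S₁ S⊆S₁)
    r₁∈S : r₁ ∈ S
    r₁∈S = subst (_∈ S) c′S≡r₁ c′S∈S
    S<S₁ : D′.Below S S₁
    S<S₁ = D′.⊂⇒below c′S∈S p (Agreement.proc-c⇒d-self G S₁ outside valid (proj₁ T₁)) S⊆S₁ S≢S₁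
    avoids-r₂ : ∀ {y} → y ∈ S → Minus S₁ r₂ y
    avoids-r₂ {y} y∈S = subst (λ r → Minus S₁ r y) c′S₁≡r₂ (S<S₁ y∈S)

mainTheorem5 : ∀ {n} (G : Graph n) → IsTree G →
    (c : Subset n → Fin n) → ValidChooser G c →
    (r₁ r₂ : Fin n) (S₁ : Subset n) → IsT G c r₁ S₁ → r₂ ∈ S₁ → r₂ ≢ r₁ →
    (c' : Subset n → Fin n) → MoveAhead G c S₁ r₂ c' →
    (∀ u → u ∉ S₁ → ∀ w → (Hub G c' w u → Hub G c w u) × (Hub G c w u → Hub G c' w u))
    × (∀ u → u ∈ S₁ → ∀ w → Hub G c' w u → Hub G c w u ⊎ w ≡ r₂)
    × (∀ u → u ∈ S₁ → ¬ Reach G (Minus S₁ r₂) r₁ u → ¬ Hub G c' r₁ u)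
mainTheorem5 G tree c valid r₁ r₂ S₁ T₁ _ r₂≢r₁ c' moved@(_ , _ , outside) =
    (λ _ u∉S₁ _ → hub-d⇒c u∉S₁ , hub-c⇒d u∉S₁)
  , (λ _ _ _ → hub-moveAhead moved)
  , (λ _ _ → r₁-not-hub-beyond-r₂ tree valid T₁ r₂≢r₁ moved)
  where open Agreement G S₁ outside
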